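{- For all formulas $A_1,X_1,\dots,A_n,X_n,B,Y$: the I/O sequent $(A_1,X_1),\dots,(A_n,X_n)\vdash(B,Y)$ is derivable in $\mathbf{C}_3$ iff for every partition $(I,J)\in\mathcal{P}(\{1,\dots,n\})$ at least one of the following holds: (i) $B,\{X_j\}_{j\in J}\Rightarrow A_i$ is derivable in LK for some $i\in I$; (ii) $B,\{X_j\}_{j\in J}\Rightarrow$ is derivable in LK; (iii) $\{X_j\}_{j\in J}\Rightarrow Y$ is derivable in LK.
   Context: Formulas are classical propositional formulas; $\models$ is classical entailment. An LK sequent $\Gamma\Rightarrow\Delta$ is derivable in LK iff $\bigwedge\Gamma\models\bigvee\Delta$ (empty conjunction $=\top$, empty disjunction $=\bot$). An I/O pair is an ordered pair $(A,X)$ of formulas; an I/O sequent has the form $G\vdash(B,Y)$ with $G$ a finite multiset of pairs. The calculus $\mathbf{C}_3$ has the rules: (IN) from $B\Rightarrow$ infer $G\vdash(B,Y)$; (OUT) from $\Rightarrow Y$ infer $G\vdash(B,Y)$; (E3) from the LK sequent $B\Rightarrow A$ and $G\vdash(B\wedge X,Y\vee\neg X)$ infer $(A,X),G\vdash(B,Y)$. An I/O sequent is derivable in $\mathbf{C}_3$ if it is the root of a finite tree built with these rules in which every LK-sequent premise is derivable in LK. $\mathcal{P}(S)$ denotes the set of pairs $(I,J)$ with $I\cup J=S$ and $I\cap J=\emptyset$. -}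

module Defs where

open import Data.Nat using (ℕ; suc)
open import Data.Bool using (Bool; true; false; _∧_; _∨_; not)
open import Data.List using (List; []; _∷_; foldr)
open import Data.Fin using (Fin; zero; suc)
open import Data.Fin.Subset using (Subset; Side; inside; outside)
open import Data.Vec using ([]; _∷_)
open import Data.Product using (_×_; _,_)
open import Relation.Binary.PropositionalEquality using (_≡_)
open import Data.List.Relation.Binary.Permutation.Propositional using (_↭_)

data Formula : Set where
  var  : ℕ → Formula
  ⊤f   : Formula
  ⊥f   : Formula
  ¬f_  : Formula → Formula
  _∧f_ : Formula → Formula → Formula
  _∨f_ : Formula → Formula → Formula
  _⇒f_ : Formula → Formula → Formula

Valuation : Set
Valuation = ℕ → Bool

⟦_⟧ : Formula → Valuation → Bool
⟦ var p ⟧ v = v p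
⟦ ⊤f ⟧ v = true
⟦ ⊥f ⟧ v = false
⟦ ¬f A ⟧ v = not (⟦ A ⟧ v)
⟦ A ∧f B ⟧ v = ⟦ A ⟧ v ∧ ⟦ B ⟧ v
⟦ A ∨f B ⟧ v = ⟦ A ⟧ v ∨ ⟦ B ⟧ v
⟦ A ⇒f B ⟧ v = not (⟦ A ⟧ v) ∨ ⟦ B ⟧ v

_⊨_ : Formula → Formula → Set
A ⊨ B = (v : Valuation) → ⟦ A ⟧ v ≡ true → ⟦ B ⟧ v ≡ true

⋀ : List Formula → Formula
⋀ = foldr _∧f_ ⊤f

⋁ : List Formula → Formula
⋁ = foldr _∨f_ ⊥f

-- LK-derivability of the sequent Γ ⇒ Δ, via the stated characterisation
-- (Γ ⇒ Δ derivable in LK iff ⋀Γ ⊨ ⋁Δ).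
LK : List Formula → List Formula → Set
LK Γ Δ = ⋀ Γ ⊨ ⋁ Δ

-- I/O pairs; the left side of an I/O sequent is a finite multiset of pairs,
-- represented as a list taken up to permutation.
Pair : Set
Pair = Formula × Formula

data C3 : List Pair → Pair → Set where
  IN  : ∀ {G B Y} → LK (B ∷ []) [] → C3 G (B , Y)
  OUT : ∀ {G B Y} → LK [] (Y ∷ []) → C3 G (B , Y)
  E3  : ∀ {G G' A X B Y} →
        G ↭ ((A , X) ∷ G') →
        LK (B ∷ []) (A ∷ []) →
        C3 G' (B ∧f X , Y ∨f (¬f X)) →
        C3 G (B , Y)

select : ∀ {n} → Subset n → (Fin n → Formula) → List Formula
select [] X = []
select (inside ∷ J) X = X zero ∷ select J (λ i → X (suc i))
select (outside ∷ J) X = select J (λ i → X (suc i))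

module Submission where

-- Soundness: every rule of C3 preserves the partition condition. For E3 with
-- principal pair (A, X), a partition either puts the pair on the I side, where
-- B ⇒ A gives (i), or on the J side, where the condition for the premise
-- (B ∧ X, Y ∨ ¬X) with the remaining pairs is literally the condition for the
-- conclusion with X added to the context. Completeness: the partition with
-- J = ∅ yields IN, OUT, or a pair whose input follows from B; apply E3 to that
-- pair and recurse on the smaller multiset, whose condition is that of the
-- partitions sending the removed pair to J.

open import Data.Bool using (true; false; _∧_; _∨_; not)
open import Data.Bool.Properties using (∨-identityʳ)
open import Data.Fin using (Fin; zero; suc)
open import Data.Fin.Subset using (Subset; _∈_; _∪_; _∩_; ⊤; ⊥; inside; outside)
open import Data.List using (List; []; _∷_; _++_; length; tabulate)
open import Data.List.Membership.Propositional using (find)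
open import Data.List.Membership.Propositional.Properties using (∈-∃++)
open import Data.List.Relation.Binary.Permutation.Propositional
  using (_↭_; refl; prep; swap; trans; ↭-sym)
open import Data.List.Relation.Binary.Permutation.Propositional.Properties
  using (All-resp-↭; Any-resp-↭; ↭-length; shift)
open import Data.List.Relation.Unary.All using (All; []; _∷_)
open import Data.List.Relation.Unary.Any as Any using (Any; here; there)
open import Data.Nat using (ℕ; zero; suc)
open import Data.Nat.Properties using (suc-injective)
open import Data.Product using (Σ; _×_; _,_; ∃; ∃₂)
open import Data.Sum using (_⊎_; inj₁; inj₂)
open import Data.Vec using ([]; _∷_; here; there)
open import Data.Vec.Properties using (∷-injectiveʳ)
open import Function using (_∘_)
open import Function.Bundles using (_⇔_; mk⇔; Equivalence)
open import Relation.Binary.PropositionalEquality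
  using (_≡_; refl; sym; cong; subst) renaming (trans to ≡-trans)

open import Defs

open Equivalence using (to; from)

Sat : Valuation → List Formula → Set
Sat v = All (λ F → ⟦ F ⟧ v ≡ true)

∧≡true⇔ : ∀ {a b} → a ∧ b ≡ true ⇔ (a ≡ true × b ≡ true)
∧≡true⇔ {true} = mk⇔ (refl ,_) (λ (_ , b) → b)
∧≡true⇔ {false} = mk⇔ (λ ()) (λ ())

∨¬≡true⇔ : ∀ {y x} → y ∨ not x ≡ true ⇔ (x ≡ true → y ≡ true)
∨¬≡true⇔ {true} = mk⇔ (λ _ _ → refl) (λ _ → refl)
∨¬≡true⇔ {false} {true} = mk⇔ (λ ()) (λ f → f refl)
∨¬≡true⇔ {false} {false} = mk⇔ (λ _ ()) (λ _ → refl)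

⋀-Sat : ∀ Γ {v} → ⟦ ⋀ Γ ⟧ v ≡ true ⇔ Sat v Γ
⋀-Sat [] = mk⇔ (λ _ → []) (λ _ → refl)
⋀-Sat (F ∷ Γ) = mk⇔
  (λ h → let (f , g) = ∧≡true⇔ .to h in f ∷ ⋀-Sat Γ .to g)
  (λ { (f ∷ g) → ∧≡true⇔ .from (f , ⋀-Sat Γ .from g) })

LK-singletonʳ : ∀ Γ F → LK Γ (F ∷ []) ⇔ (∀ v → Sat v Γ → ⟦ F ⟧ v ≡ true)
LK-singletonʳ Γ F = mk⇔
  (λ ⊢ v g → ≡-trans (sym (∨-identityʳ (⟦ F ⟧ v))) (⊢ v (⋀-Sat Γ .from g)))
  (λ ⊨F v h → ≡-trans (∨-identityʳ (⟦ F ⟧ v)) (⊨F v (⋀-Sat Γ .to h)))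

LK-strengthenˡ : ∀ Γ Γ′ Δ → (∀ {v} → Sat v Γ′ → Sat v Γ) → LK Γ Δ → LK Γ′ Δ
LK-strengthenˡ Γ Γ′ Δ f ⊢ v h = ⊢ v (⋀-Sat Γ .from (f (⋀-Sat Γ′ .to h)))

LK-resp-↭ˡ : ∀ {Γ Γ′} Δ → Γ ↭ Γ′ → LK Γ Δ → LK Γ′ Δ
LK-resp-↭ˡ Δ p = LK-strengthenˡ _ _ Δ (All-resp-↭ (↭-sym p))

LK-weakenˡ : ∀ B Γ Δ → LK (B ∷ []) Δ → LK (B ∷ Γ) Δ
LK-weakenˡ B Γ Δ = LK-strengthenˡ (B ∷ []) (B ∷ Γ) Δ λ { (b ∷ _) → b ∷ [] }

LK-[]-weakenˡ : ∀ Γ Δ → LK [] Δ → LK Γ Δ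
LK-[]-weakenˡ Γ Δ = LK-strengthenˡ [] Γ Δ λ _ → []

LK-∧ˡ : ∀ B X Γ Δ → LK (B ∧f X ∷ Γ) Δ ⇔ LK (B ∷ X ∷ Γ) Δ
LK-∧ˡ B X Γ Δ = mk⇔
  (LK-strengthenˡ (B ∧f X ∷ Γ) (B ∷ X ∷ Γ) Δ λ { (b ∷ x ∷ g) →
     ∧≡true⇔ .from (b , x) ∷ g })
  (LK-strengthenˡ (B ∷ X ∷ Γ) (B ∧f X ∷ Γ) Δ λ { (bx ∷ g) →
     let (b , x) = ∧≡true⇔ .to bx in b ∷ x ∷ g })

LK-¬ʳ : ∀ X Γ Y → LK Γ (Y ∨f (¬f X) ∷ []) ⇔ LK (X ∷ Γ) (Y ∷ [])
LK-¬ʳ X Γ Y = mk⇔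
  (λ ⊢ → LK-singletonʳ (X ∷ Γ) Y .from λ { v (x ∷ g) →
     ∨¬≡true⇔ .to (LK-singletonʳ Γ (Y ∨f (¬f X)) .to ⊢ v g) x })
  (λ ⊢ → LK-singletonʳ Γ (Y ∨f (¬f X)) .from λ v g →
     ∨¬≡true⇔ .from λ x → LK-singletonʳ (X ∷ Γ) Y .to ⊢ v (x ∷ g))

-- Split G Is Js is a partition (I, J) of the multiset G: Is lists the pairs
-- put in I, Js the outputs X of the pairs put in J.
data Split : List Pair → List Pair → List Formula → Set where
  nil : Split [] [] []
  toI : ∀ {p G Is Js} → Split G Is Js → Split (p ∷ G) (p ∷ Is) Js
  toJ : ∀ {A X G Is Js} → Split G Is Js → Split ((A , X) ∷ G) Is (X ∷ Js)

split-resp-↭ : ∀ {G H Is Js} → G ↭ H → Split H Is Js →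
               ∃₂ λ Is′ Js′ → Split G Is′ Js′ × Is′ ↭ Is × Js′ ↭ Js
split-resp-↭ refl s = _ , _ , s , refl , refl
split-resp-↭ (prep _ p) (toI s) =
  let _ , _ , s′ , i , j = split-resp-↭ p s in _ , _ , toI s′ , prep _ i , j
split-resp-↭ (prep _ p) (toJ s) =
  let _ , _ , s′ , i , j = split-resp-↭ p s in _ , _ , toJ s′ , i , prep _ j
split-resp-↭ (swap _ _ p) (toI (toI s)) =
  let _ , _ , s′ , i , j = split-resp-↭ p s in _ , _ , toI (toI s′) , swap _ _ i , j
split-resp-↭ (swap _ _ p) (toI (toJ s)) =
  let _ , _ , s′ , i , j = split-resp-↭ p s in _ , _ , toJ (toI s′) , prep _ i , prep _ j
split-resp-↭ (swap _ _ p) (toJ (toI s)) =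
  let _ , _ , s′ , i , j = split-resp-↭ p s in _ , _ , toI (toJ s′) , prep _ i , prep _ j
split-resp-↭ (swap _ _ p) (toJ (toJ s)) =
  let _ , _ , s′ , i , j = split-resp-↭ p s in _ , _ , toJ (toJ s′) , i , swap _ _ j
split-resp-↭ (trans p q) s =
  let _ , _ , s₁ , i₁ , j₁ = split-resp-↭ q s
      _ , _ , s₂ , i₂ , j₂ = split-resp-↭ p s₁
  in _ , _ , s₂ , trans i₂ i₁ , trans j₂ j₁

data Alternatives (B Y : Formula) (Is : List Pair) (Js : List Formula) : Set where
  input-entailed       : Any (λ (A , _) → LK (B ∷ Js) (A ∷ [])) Is → Alternatives B Y Is Js
  context-inconsistent : LK (B ∷ Js) [] → Alternatives B Y Is Js
  output-entailed      : LK Js (Y ∷ []) → Alternatives B Y Is Js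

Criterion : List Pair → Formula → Formula → Set
Criterion G B Y = ∀ {Is Js} → Split G Is Js → Alternatives B Y Is Js

alternatives-resp-↭ : ∀ {B Y Is Is′ Js Js′} → Is′ ↭ Is → Js′ ↭ Js →
                      Alternatives B Y Is′ Js′ → Alternatives B Y Is Js
alternatives-resp-↭ {B} i j (input-entailed a) =
  input-entailed (Any-resp-↭ i (Any.map (λ {(A , _)} → LK-resp-↭ˡ (A ∷ []) (prep B j)) a))
alternatives-resp-↭ {B} i j (context-inconsistent ⊢) =
  context-inconsistent (LK-resp-↭ˡ [] (prep B j) ⊢)
alternatives-resp-↭ {Y = Y} i j (output-entailed ⊢) =
  output-entailed (LK-resp-↭ˡ (Y ∷ []) j ⊢)

criterion-resp-↭ : ∀ {G H B Y} → G ↭ H → Criterion G B Y → Criterion H B Y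
criterion-resp-↭ p c s =
  let _ , _ , s′ , i , j = split-resp-↭ p s in alternatives-resp-↭ i j (c s′)

alternatives-shift : ∀ {B X Y Is Js} →
  Alternatives (B ∧f X) (Y ∨f (¬f X)) Is Js ⇔ Alternatives B Y Is (X ∷ Js)
alternatives-shift {B} {X} {Y} {Is} {Js} = mk⇔ push pull
  where
  push : Alternatives (B ∧f X) (Y ∨f (¬f X)) Is Js → Alternatives B Y Is (X ∷ Js)
  push (input-entailed a) =
    input-entailed (Any.map (λ {(A , _)} → LK-∧ˡ B X Js (A ∷ []) .to) a)
  push (context-inconsistent ⊢) = context-inconsistent (LK-∧ˡ B X Js [] .to ⊢)
  push (output-entailed ⊢) = output-entailed (LK-¬ʳ X Js Y .to ⊢)
  pull : Alternatives B Y Is (X ∷ Js) → Alternatives (B ∧f X) (Y ∨f (¬f X)) Is Js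
  pull (input-entailed a) =
    input-entailed (Any.map (λ {(A , _)} → LK-∧ˡ B X Js (A ∷ []) .from) a)
  pull (context-inconsistent ⊢) = context-inconsistent (LK-∧ˡ B X Js [] .from ⊢)
  pull (output-entailed ⊢) = output-entailed (LK-¬ʳ X Js Y .from ⊢)

C3⇒criterion : ∀ {G B Y} → C3 G (B , Y) → Criterion G B Y
C3⇒criterion {B = B} (IN ⊢¬B) {Js = Js} _ = context-inconsistent (LK-weakenˡ B Js [] ⊢¬B)
C3⇒criterion {Y = Y} (OUT ⊢Y) {Js = Js} _ = output-entailed (LK-[]-weakenˡ Js (Y ∷ []) ⊢Y)
C3⇒criterion {B = B} (E3 {A = A} G↭ ⊢A d) = criterion-resp-↭ (↭-sym G↭) λ where
  (toI {Js = Js} _) → input-entailed (here (LK-weakenˡ B Js (A ∷ []) ⊢A))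
  (toJ s) → alternatives-shift .to (C3⇒criterion d s)

all-inside : ∀ G → Split G G []
all-inside [] = nil
all-inside (_ ∷ G) = toI (all-inside G)

Any⇒↭-cons : ∀ {P : Pair → Set} {G} → Any P G → ∃₂ λ p G′ → P p × G ↭ p ∷ G′
Any⇒↭-cons any =
  let p , p∈G , Pp = find any
      ys , zs , G≡ = ∈-∃++ p∈G
  in p , ys ++ zs , Pp , subst (_↭ p ∷ ys ++ zs) (sym G≡) (shift p ys zs)

criterion⇒C3 : ∀ {G B Y} → Criterion G B Y → C3 G (B , Y)
criterion⇒C3 = go _ refl
  where
  go : ∀ n {G B Y} → length G ≡ n → Criterion G B Y → C3 G (B , Y)
  go n {G} len c with c (all-inside G)
  ... | context-inconsistent ⊢¬B = IN ⊢¬B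
  ... | output-entailed ⊢Y = OUT ⊢Y
  go zero {[]} len c | input-entailed ()
  go (suc n) {G} len c | input-entailed any
    with (A , X) , G′ , ⊢A , G↭ ← Any⇒↭-cons any =
    E3 G↭ ⊢A (go n len′ λ s →
      alternatives-shift .from (criterion-resp-↭ G↭ c (toJ s)))
    where
    len′ : length G′ ≡ n
    len′ = suc-injective (≡-trans (sym (↭-length G↭)) len)

C3⇔criterion : ∀ {G B Y} → C3 G (B , Y) ⇔ Criterion G B Y
C3⇔criterion = mk⇔ C3⇒criterion criterion⇒C3

pairsIn : ∀ {n} → Subset n → (Fin n → Formula) → (Fin n → Formula) → List Pair
pairsIn [] A X = []
pairsIn (inside ∷ I) A X = (A zero , X zero) ∷ pairsIn I (A ∘ suc) (X ∘ suc)
pairsIn (outside ∷ I) A X = pairsIn I (A ∘ suc) (X ∘ suc)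

Any-pairsIn : ∀ {n} {P : Pair → Set} (I : Subset n) A X →
              Any P (pairsIn I A X) ⇔ ∃ λ i → i ∈ I × P (A i , X i)
Any-pairsIn [] A X = mk⇔ (λ ()) (λ ())
Any-pairsIn (inside ∷ I) A X = mk⇔
  (λ { (here p) → zero , here , p
     ; (there a) →
         let i , i∈I , p = Any-pairsIn I (A ∘ suc) (X ∘ suc) .to a in suc i , there i∈I , p })
  (λ { (zero , _ , p) → here p
     ; (suc i , there i∈I , p) →
         there (Any-pairsIn I (A ∘ suc) (X ∘ suc) .from (i , i∈I , p)) })
Any-pairsIn (outside ∷ I) A X = mk⇔
  (λ a →
     let i , i∈I , p = Any-pairsIn I (A ∘ suc) (X ∘ suc) .to a in suc i , there i∈I , p)
  (λ { (suc i , there i∈I , p) →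
         Any-pairsIn I (A ∘ suc) (X ∘ suc) .from (i , i∈I , p) })

partition⇒split : ∀ {n} (I J : Subset n) A X → I ∪ J ≡ ⊤ → I ∩ J ≡ ⊥ →
                  Split (tabulate (λ i → (A i , X i))) (pairsIn I A X) (select J X)
partition⇒split [] [] A X _ _ = nil
partition⇒split (inside ∷ I) (outside ∷ J) A X I∪J I∩J =
  toI (partition⇒split I J (A ∘ suc) (X ∘ suc) (∷-injectiveʳ I∪J) (∷-injectiveʳ I∩J))
partition⇒split (outside ∷ I) (inside ∷ J) A X I∪J I∩J =
  toJ (partition⇒split I J (A ∘ suc) (X ∘ suc) (∷-injectiveʳ I∪J) (∷-injectiveʳ I∩J))
partition⇒split (inside ∷ I) (inside ∷ J) A X _ ()
partition⇒split (outside ∷ I) (outside ∷ J) A X () _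

split⇒partition : ∀ {n} A X {Is Js} →
  Split (tabulate {n = n} (λ i → (A i , X i))) Is Js →
  ∃₂ λ I J → I ∪ J ≡ ⊤ × I ∩ J ≡ ⊥ × Is ≡ pairsIn I A X × Js ≡ select J X
split⇒partition {zero} A X nil = [] , [] , refl , refl , refl , refl
split⇒partition {suc n} A X (toI s) =
  let I , J , I∪J , I∩J , Is≡ , Js≡ = split⇒partition (A ∘ suc) (X ∘ suc) s
  in inside ∷ I , outside ∷ J , cong (inside ∷_) I∪J , cong (outside ∷_) I∩J ,
     cong (_ ∷_) Is≡ , Js≡
split⇒partition {suc n} A X (toJ s) =
  let I , J , I∪J , I∩J , Is≡ , Js≡ = split⇒partition (A ∘ suc) (X ∘ suc) s
  in outside ∷ I , inside ∷ J , cong (inside ∷_) I∪J , cong (outside ∷_) I∩J ,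
     Is≡ , cong (_ ∷_) Js≡

partitions⇒criterion : ∀ {n} A X {B Y} →
  ((I J : Subset n) → I ∪ J ≡ ⊤ → I ∩ J ≡ ⊥ →
     Alternatives B Y (pairsIn I A X) (select J X)) →
  Criterion (tabulate (λ i → (A i , X i))) B Y
partitions⇒criterion A X h s with split⇒partition A X s
... | I , J , I∪J , I∩J , refl , refl = h I J I∪J I∩J

alternatives-pairsIn : ∀ {n} (I : Subset n) A X {B Y Js} →
  Alternatives B Y (pairsIn I A X) Js
    ⇔ (∃ (λ i → i ∈ I × LK (B ∷ Js) (A i ∷ [])) ⊎ LK (B ∷ Js) [] ⊎ LK Js (Y ∷ []))
alternatives-pairsIn I A X = mk⇔
  (λ { (input-entailed a) → inj₁ (Any-pairsIn I A X .to a)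
     ; (context-inconsistent ⊢) → inj₂ (inj₁ ⊢)
     ; (output-entailed ⊢) → inj₂ (inj₂ ⊢) })
  (λ { (inj₁ a) → input-entailed (Any-pairsIn I A X .from a)
     ; (inj₂ (inj₁ ⊢)) → context-inconsistent ⊢
     ; (inj₂ (inj₂ ⊢)) → output-entailed ⊢ })

lemma6 : (n : ℕ) (A X : Fin n → Formula) (B Y : Formula) →
    C3 (tabulate (λ i → (A i , X i))) (B , Y)
      ⇔ ((I J : Subset n) → I ∪ J ≡ ⊤ → I ∩ J ≡ ⊥ →
           (Σ (Fin n) (λ i → i ∈ I × LK (B ∷ select J X) (A i ∷ [])))
           ⊎ LK (B ∷ select J X) []
           ⊎ LK (select J X) (Y ∷ []))
lemma6 n A X B Y = mk⇔
  (λ d I J I∪J I∩J →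
     alternatives-pairsIn I A X .to (C3⇔criterion .to d (partition⇒split I J A X I∪J I∩J)))
  (λ h → C3⇔criterion .from (partitions⇒criterion A X λ I J I∪J I∩J →
     alternatives-pairsIn I A X .from (h I J I∪J I∩J)))
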